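{- Let $\mathcal{G}$ denote the class of all graphs of order at least $2$ with no isolated vertex. Then \[ \sup_{G \in \mathcal{G}} \frac{\gamma_g(G)}{\Psi_g^+(G)} \ge \frac{11}{10}. \]
   Context: All graphs are finite and simple. A vertex dominates itself and its neighbors. In the domination game on $G$, two players, Dominator and Staller, alternately choose vertices of $G$, each chosen vertex being required to dominate at least one vertex not dominated by the previously chosen vertices; the game ends when the chosen vertices form a dominating set. Dominator aims to minimize and Staller to maximize the number of moves; $\gamma_g(G)$ is the number of moves when Dominator moves first and both play optimally. For a set $S$ of vertices, a vertex $v\in S$ is an enclave of $S$ if $N[v] \subseteq S$; $S$ is enclaveless if it contains no enclave. In the competition-enclaveless game, Maximizer and Minimizer alternately choose a vertex $v$ not in the set $S$ of previously chosen vertices such that $S\cup\{v\}$ is enclaveless, until no such vertex exists; Maximizer aims to maximize and Minimizer to minimize the final $|S|$. $\Psi_g^+(G)$ is the final $|S|$ when Maximizer moves first and both play optimally. -}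

module Defs where

open import Data.Nat using (ℕ; zero; suc; _+_; _⊔_; _⊓_; _≤_)
open import Data.Bool using (Bool; true; false; _∧_; _∨_; not; if_then_else_)
open import Data.Fin using (Fin; zero; suc; _≟_)
open import Data.Maybe using (Maybe; just; nothing)
open import Data.Product using (Σ; ∃; _×_)
open import Relation.Nullary.Decidable using (⌊_⌋)
open import Relation.Binary.PropositionalEquality using (_≡_)

record Graph : Set where
  field
    n      : ℕ
    adj    : Fin n → Fin n → Bool
    sym    : ∀ u v → adj u v ≡ adj v u
    irrefl : ∀ v → adj v v ≡ false
open Graph public

InClass : Graph → Set
InClass G = (2 ≤ n G) × (∀ v → ∃ λ u → adj G v u ≡ true)

anyFin : ∀ {m} → (Fin m → Bool) → Bool
anyFin {zero} f = false
anyFin {suc m} f = f zero ∨ anyFin (λ i → f (suc i))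

allFin : ∀ {m} → (Fin m → Bool) → Bool
allFin {zero} f = true
allFin {suc m} f = f zero ∧ allFin (λ i → f (suc i))

VSet : ℕ → Set
VSet m = Fin m → Bool

∅ : ∀ {m} → VSet m
∅ _ = false

insert : ∀ {m} → Fin m → VSet m → VSet m
insert v S u = ⌊ u ≟ v ⌋ ∨ S u

inN : (G : Graph) → Fin (n G) → Fin (n G) → Bool
inN G w u = ⌊ w ≟ u ⌋ ∨ adj G w u

dominated : (G : Graph) → VSet (n G) → Fin (n G) → Bool
dominated G S u = anyFin (λ w → S w ∧ inN G w u)

legalDom : (G : Graph) → VSet (n G) → Fin (n G) → Bool
legalDom G S v = anyFin (λ u → inN G v u ∧ not (dominated G S u))

enclave : (G : Graph) → VSet (n G) → Fin (n G) → Bool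
enclave G S v = S v ∧ allFin (λ u → not (inN G v u) ∨ S u)

enclaveless : (G : Graph) → VSet (n G) → Bool
enclaveless G S = not (anyFin (enclave G S))

legalEnc : (G : Graph) → VSet (n G) → Fin (n G) → Bool
legalEnc G S v = not (S v) ∧ enclaveless G (insert v S)

optOver : ∀ {m} → (ℕ → ℕ → ℕ) → (Fin m → Bool) → (Fin m → ℕ) → Maybe ℕ
optOver {zero} op p f = nothing
optOver {suc m} op p f with optOver op (λ i → p (suc i)) (λ i → f (suc i))
... | nothing = if p zero then just (f zero) else nothing
... | just r  = if p zero then just (op (f zero) r) else just r

-- Value = number of moves still to be played under
-- optimal play.  The fuel argument bounds the remaining number of moves;
-- with fuel n G it never runs out (each move in both games adds a new
-- vertex to S, resp. a new dominated vertex).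
gameVal : (G : Graph) → (VSet (n G) → Fin (n G) → Bool) →
          ℕ → Bool → VSet (n G) → ℕ
gameVal G legal zero maxTurn S = 0
gameVal G legal (suc k) maxTurn S
  with optOver (if maxTurn then _⊔_ else _⊓_) (legal S)
               (λ v → gameVal G legal k (not maxTurn) (insert v S))
... | nothing = 0
... | just r  = suc r

gammaG : Graph → ℕ
gammaG G = gameVal G (legalDom G) (n G) false ∅

PsiPlus : Graph → ℕ
PsiPlus G = gameVal G (legalEnc G) (n G) true ∅

-- The witness is the corona C₆ ∘ K₁ (a 6-cycle with a pendant leaf at every vertex), for which
-- γ_g = 7 while Ψ_g^+ ≤ 6, and 7/6 > 11/10.  Both game values are certified by exhaustive
-- search: a bound is checked by following one strategy of the player it favours against every
-- reply of the opponent, and such a check is sound for the game value defined by minimax.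

module Submission where

open import Defs
open import Data.Nat using (ℕ; zero; suc; _*_; _<_; _≤_; _⊔_; _⊓_; z≤n; s≤s; NonZero)
open import Data.Nat.Properties
open import Data.Bool using (Bool; true; false; _∧_; _∨_; not)
open import Data.Bool.Properties using (∨-comm; ∧-conicalˡ; ∧-conicalʳ; not-injective)
open import Data.Fin using (Fin; zero; suc; toℕ)
open import Data.Maybe using (just; nothing)
open import Data.Product using (Σ; _×_; _,_; ∃)
open import Function using (_∘_; flip)
open import Relation.Binary.Definitions using (Reflexive; Transitive)
open import Relation.Binary.PropositionalEquality using (_≡_; refl)
open import Algebra.Properties.CommutativeSemigroup *-commutativeSemigroup
  using (x∙yz≈y∙xz; x∙yz≈yx∙z)

not-∨-elim : ∀ {a b} → (not a ∨ b) ≡ true → a ≡ true → b ≡ true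
not-∨-elim b refl = b

anyFin-witness : ∀ {m} (f : Fin m → Bool) → anyFin f ≡ true → ∃ λ i → f i ≡ true
anyFin-witness {suc m} f any with f zero in f0
... | true  = zero , f0
... | false with anyFin-witness (f ∘ suc) any
...   | i , fi = suc i , fi

anyFin-false : ∀ {m} (f : Fin m → Bool) → anyFin f ≡ false → ∀ i → f i ≡ false
anyFin-false {suc m} f none i with f zero in f0
anyFin-false {suc m} f none zero    | false = f0
anyFin-false {suc m} f none (suc i) | false = anyFin-false (f ∘ suc) none i

allFin-true : ∀ {m} (f : Fin m → Bool) → allFin f ≡ true → ∀ i → f i ≡ true
allFin-true {suc m} f all zero    = ∧-conicalˡ (f zero) _ all
allFin-true {suc m} f all (suc i) = allFin-true (f ∘ suc) (∧-conicalʳ (f zero) _ all) i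

optOver-nothing : ∀ {m} op (p : Fin m → Bool) (f : Fin m → ℕ) →
                  (∀ i → p i ≡ false) → optOver op p f ≡ nothing
optOver-nothing {zero}  op p f none = refl
optOver-nothing {suc m} op p f none
  rewrite optOver-nothing op (p ∘ suc) (f ∘ suc) (none ∘ suc) | none zero = refl

optOver-closed : ∀ {m} op (P : ℕ → Set) → (∀ {x y} → P x → P y → P (op x y)) →
                 (p : Fin m → Bool) (f : Fin m → ℕ) → (∀ i → p i ≡ true → P (f i)) →
                 ∀ {r} → optOver op p f ≡ just r → P r
optOver-closed {suc m} op P close p f hyp opt
  with optOver op (p ∘ suc) (f ∘ suc) in tail
... | nothing with p zero in p0 | opt
...   | true  | refl = hyp zero p0
optOver-closed {suc m} op P close p f hyp opt | just r with p zero in p0 | opt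
...   | true  | refl =
  close (hyp zero p0) (optOver-closed op P close (p ∘ suc) (f ∘ suc) (hyp ∘ suc) tail)
...   | false | refl = optOver-closed op P close (p ∘ suc) (f ∘ suc) (hyp ∘ suc) tail

optOver-selects : ∀ {m} op (R : ℕ → ℕ → Set) → Reflexive R → Transitive R →
                  (∀ x y → R x (op x y)) → (∀ x y → R y (op x y)) →
                  (p : Fin m → Bool) (f : Fin m → ℕ) → ∀ i → p i ≡ true →
                  ∃ λ r → optOver op p f ≡ just r × R (f i) r
optOver-selects {suc m} op R refl' trans' left right p f zero p0
  with optOver op (p ∘ suc) (f ∘ suc)
... | nothing with p zero | p0
...   | true | refl = f zero , refl , refl'
optOver-selects {suc m} op R refl' trans' left right p f zero p0 | just r with p zero | p0
...   | true | refl = op (f zero) r , refl , left (f zero) r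
optOver-selects {suc m} op R refl' trans' left right p f (suc j) pj
  with optOver-selects op R refl' trans' left right (p ∘ suc) (f ∘ suc) j pj
... | r , tail , fj rewrite tail with p zero
...   | true  = op (f zero) r , refl , trans' fj (right (f zero) r)
...   | false = r , refl , fj

optOver-⊔-≥ : ∀ {m} (p : Fin m → Bool) (f : Fin m → ℕ) i → p i ≡ true →
              ∃ λ r → optOver _⊔_ p f ≡ just r × f i ≤ r
optOver-⊔-≥ = optOver-selects _⊔_ _≤_ ≤-refl ≤-trans m≤m⊔n m≤n⊔m

optOver-⊓-≤ : ∀ {m} (p : Fin m → Bool) (f : Fin m → ℕ) i → p i ≡ true →
              ∃ λ r → optOver _⊓_ p f ≡ just r × r ≤ f i
optOver-⊓-≤ = optOver-selects _⊓_ (flip _≤_) ≤-refl (flip ≤-trans) m⊓n≤m m⊓n≤n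

module GameBounds (G : Graph) (legal : VSet (n G) → Fin (n G) → Bool) where

  value : ℕ → Bool → VSet (n G) → ℕ
  value = gameVal G legal

  atLeastᵇ : ℕ → Bool → VSet (n G) → ℕ → Bool
  atLeastᵇ k       maxTurn S zero    = true
  atLeastᵇ zero    maxTurn S (suc L) = false
  atLeastᵇ (suc k) true    S (suc L) =
    anyFin (λ v → legal S v ∧ atLeastᵇ k false (insert v S) L)
  atLeastᵇ (suc k) false   S (suc L) =
    anyFin (legal S) ∧ allFin (λ v → not (legal S v) ∨ atLeastᵇ k true (insert v S) L)

  atMostᵇ : ℕ → Bool → VSet (n G) → ℕ → Bool
  atMostᵇ zero    maxTurn S U       = true
  atMostᵇ (suc k) maxTurn S zero    = not (anyFin (legal S))
  atMostᵇ (suc k) true    S (suc U) =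
    allFin (λ v → not (legal S v) ∨ atMostᵇ k false (insert v S) U)
  atMostᵇ (suc k) false   S (suc U) =
    not (anyFin (legal S)) ∨ anyFin (λ v → legal S v ∧ atMostᵇ k true (insert v S) U)

  value-stuck : ∀ k maxTurn S → anyFin (legal S) ≡ false → value k maxTurn S ≡ 0
  value-stuck zero    maxTurn S stuck = refl
  value-stuck (suc k) true    S stuck
    rewrite optOver-nothing _⊔_ (legal S) (λ v → value k false (insert v S))
              (anyFin-false (legal S) stuck) = refl
  value-stuck (suc k) false   S stuck
    rewrite optOver-nothing _⊓_ (legal S) (λ v → value k true (insert v S))
              (anyFin-false (legal S) stuck) = refl

  atLeastᵇ-sound : ∀ k maxTurn S L → atLeastᵇ k maxTurn S L ≡ true → L ≤ value k maxTurn S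
  atLeastᵇ-sound k       maxTurn S zero    _ = z≤n
  atLeastᵇ-sound (suc k) true    S (suc L) c
    with i , good ← anyFin-witness _ c
    with r , opt , i≤r ← optOver-⊔-≥ (legal S) (λ v → value k false (insert v S)) i
                            (∧-conicalˡ _ _ good)
    rewrite opt =
      s≤s (≤-trans (atLeastᵇ-sound k false (insert i S) L (∧-conicalʳ _ _ good)) i≤r)
  atLeastᵇ-sound (suc k) false   S (suc L) c
    with i , legal-i ← anyFin-witness (legal S) (∧-conicalˡ _ _ c)
    with r , opt , _ ← optOver-⊓-≤ (legal S) (λ v → value k true (insert v S)) i legal-i
    rewrite opt =
      s≤s (optOver-closed _⊓_ (L ≤_) ⊓-glb (legal S) _ every opt)
    where
    every : ∀ v → legal S v ≡ true → L ≤ value k true (insert v S)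
    every v legal-v = atLeastᵇ-sound k true (insert v S) L
      (not-∨-elim (allFin-true _ (∧-conicalʳ _ _ c) v) legal-v)

  atMostᵇ-sound : ∀ k maxTurn S U → atMostᵇ k maxTurn S U ≡ true → value k maxTurn S ≤ U
  atMostᵇ-sound zero    maxTurn S U       _ = z≤n
  atMostᵇ-sound (suc k) maxTurn S zero    c =
    ≤-reflexive (value-stuck (suc k) maxTurn S (not-injective c))
  atMostᵇ-sound (suc k) true    S (suc U) c
    with optOver _⊔_ (legal S) (λ v → value k false (insert v S)) in opt
  ... | nothing = z≤n
  ... | just r  = s≤s (optOver-closed _⊔_ (_≤ U) ⊔-lub (legal S) _ every opt)
    where
    every : ∀ v → legal S v ≡ true → value k false (insert v S) ≤ U
    every v legal-v = atMostᵇ-sound k false (insert v S) U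
      (not-∨-elim (allFin-true _ c v) legal-v)
  atMostᵇ-sound (suc k) false   S (suc U) c with anyFin (legal S) in moves
  ... | false = ≤-trans (≤-reflexive (value-stuck (suc k) false S moves)) z≤n
  ... | true
    with i , good ← anyFin-witness _ c
    with r , opt , r≤i ← optOver-⊓-≤ (legal S) (λ v → value k true (insert v S)) i
                            (∧-conicalˡ _ _ good)
    rewrite opt =
      s≤s (≤-trans r≤i (atMostᵇ-sound k true (insert i S) U (∧-conicalʳ _ _ good)))

cross-<-≤-trans : ∀ a b c d p q .{{_ : NonZero p}} →
                  c * a < d * b → d * p ≤ c * q → p * a < q * b
cross-<-≤-trans a b c d p q ca<db dp≤cq = *-cancelˡ-< c (p * a) (q * b) (begin-strict
  c * (p * a)  ≡⟨ x∙yz≈y∙xz c p a ⟩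
  p * (c * a)  <⟨ *-monoʳ-< p ca<db ⟩
  p * (d * b)  ≡⟨ x∙yz≈yx∙z p d b ⟩
  d * p * b    ≤⟨ *-monoˡ-≤ b dp≤cq ⟩
  c * q * b    ≡⟨ *-assoc c q b ⟩
  c * (q * b)  ∎)
  where open ≤-Reasoning

ratio-<-via-7/6 : ∀ a b x y → 10 * a < 11 * b → x ≤ 6 → 7 ≤ y → a * x < b * y
ratio-<-via-7/6 a b x y 10a<11b x≤6 7≤y = begin-strict
  a * x  ≤⟨ *-monoʳ-≤ a x≤6 ⟩
  a * 6  ≡⟨ *-comm a 6 ⟩
  6 * a  <⟨ cross-<-≤-trans a b 10 11 6 7 10a<11b (m≤m+n 66 4) ⟩
  7 * b  ≡⟨ *-comm 7 b ⟩
  b * 7  ≤⟨ *-monoʳ-≤ b 7≤y ⟩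
  b * y  ∎
  where open ≤-Reasoning

-- Vertices 0–5 form the cycle, and the leaf i + 6 hangs at i.
corona-edge : ℕ → ℕ → Bool
corona-edge 0 1  = true
corona-edge 1 2  = true
corona-edge 2 3  = true
corona-edge 3 4  = true
corona-edge 4 5  = true
corona-edge 0 5  = true
corona-edge 0 6  = true
corona-edge 1 7  = true
corona-edge 2 8  = true
corona-edge 3 9  = true
corona-edge 4 10 = true
corona-edge 5 11 = true
corona-edge _ _  = false

C₆∘K₁ : Graph
C₆∘K₁ = record
  { n      = 12
  ; adj    = adjacent
  ; sym    = λ u v → ∨-comm (corona-edge (toℕ u) (toℕ v)) _
  ; irrefl = λ v → not-injective (allFin-true (λ v → not (adjacent v v)) refl v)
  }
  where
  adjacent : Fin 12 → Fin 12 → Bool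
  adjacent u v = corona-edge (toℕ u) (toℕ v) ∨ corona-edge (toℕ v) (toℕ u)

C₆∘K₁-inClass : InClass C₆∘K₁
C₆∘K₁-inClass = s≤s (s≤s z≤n) , λ v →
  anyFin-witness _ (allFin-true (λ v → anyFin (adj C₆∘K₁ v)) refl v)

PsiPlus-≥ : ∀ G L → GameBounds.atLeastᵇ G (legalEnc G) (n G) true ∅ L ≡ true → L ≤ PsiPlus G
PsiPlus-≥ G = GameBounds.atLeastᵇ-sound G (legalEnc G) (n G) true ∅

PsiPlus-≤ : ∀ G U → GameBounds.atMostᵇ G (legalEnc G) (n G) true ∅ U ≡ true → PsiPlus G ≤ U
PsiPlus-≤ G = GameBounds.atMostᵇ-sound G (legalEnc G) (n G) true ∅

gammaG-≥ : ∀ G L → GameBounds.atLeastᵇ G (legalDom G) (n G) false ∅ L ≡ true → L ≤ gammaG G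
gammaG-≥ G = GameBounds.atLeastᵇ-sound G (legalDom G) (n G) false ∅

PsiPlus-C₆∘K₁-positive : 0 < PsiPlus C₆∘K₁
PsiPlus-C₆∘K₁-positive = PsiPlus-≥ C₆∘K₁ 1 refl

PsiPlus-C₆∘K₁-≤ : PsiPlus C₆∘K₁ ≤ 6
PsiPlus-C₆∘K₁-≤ = PsiPlus-≤ C₆∘K₁ 6 refl

gammaG-C₆∘K₁-≥ : 7 ≤ gammaG C₆∘K₁
gammaG-C₆∘K₁-≥ = gammaG-≥ C₆∘K₁ 7 refl

theorem2p4 : (a b : ℕ) → 0 < b → 10 * a < 11 * b →
    Σ Graph (λ G → InClass G × 0 < PsiPlus G × a * PsiPlus G < b * gammaG G)
theorem2p4 a b _ 10a<11b =
  C₆∘K₁ , C₆∘K₁-inClass , PsiPlus-C₆∘K₁-positive ,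
  ratio-<-via-7/6 a b _ _ 10a<11b PsiPlus-C₆∘K₁-≤ gammaG-C₆∘K₁-≥
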